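{- Let $m\ge 3$, $X=\mathbb{F}_{2^m}\setminus\{0,1\}$, and let $W_2,W_3$ be as in the context. Then the triple $(X,W_2,W_3)$ is a $\mathrm{GDD}(2^m-2,2,3)$ with balance parameter $\lambda_3=1$.
   Context: $\mathbb{F}_{2^m}$ is the finite field with $2^m$ elements, with zero $0$ and unity $1$; all sums are in $\mathbb{F}_{2^m}$. For each integer $k\ge 2$, $W_k=\{B\subset X : |B|=k,\ \sum_{i\in B} i=1,\ \text{and } \binom{B}{\ell}\cap W_\ell=\emptyset \text{ for all } 2\le \ell\le k-3\}$ (recursive definition; $\binom{B}{\ell}$ is the set of $\ell$-subsets of $B$; the last condition is vacuous for $k\le 4$). A group divisible design $\mathrm{GDD}(v,n,k)$ is a triple $(X,\mathcal{G},\mathcal{B})$ where $X$ is a $v$-set, $\mathcal{G}$ is a collection of $n$-subsets of $X$ (groups) and $\mathcal{B}$ is a collection of $k$-subsets of $X$ (blocks), such that (i) $\mathcal{G}$ is a partition of $X$; (ii) no two elements of a block lie together in a common group; (iii) every pair of distinct elements of $X$ from different groups occurs together in exactly $\lambda$ blocks; $\lambda$ is called the balance parameter. -}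

module Defs where

open import Data.Nat using (ℕ; zero; suc)
open import Data.Bool using (Bool; true; false; if_then_else_; _∧_; not)
open import Data.Fin using (Fin)
import Data.Fin as F
open import Data.Fin.Subset using (Subset; _∈_; _⊆_; ∣_∣; inside; outside)
open import Data.Vec using (Vec; foldr′; zipWith; tabulate)
open import Data.List using (List; length)
open import Data.List.Membership.Propositional using () renaming (_∈_ to _∈ₗ_)
open import Data.List.Relation.Unary.Unique.Propositional using (Unique)
open import Data.Product using (Σ; ∃; _×_; _,_)
open import Function.Bundles using (_↔_; Inverse; _⇔_)
open import Algebra.Core using (Op₁; Op₂)
open import Algebra.Structures using (IsCommutativeRing)
open import Relation.Binary.PropositionalEquality using (_≡_; _≢_; refl; sym; trans; cong)
open import Relation.Nullary using (¬_; Dec; yes; no)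
open import Relation.Nullary.Decidable using (⌊_⌋)

record FiniteField (q : ℕ) : Set₁ where
  field
    Carrier    : Set
    _+_        : Op₂ Carrier
    _*_        : Op₂ Carrier
    -_         : Op₁ Carrier
    0#         : Carrier
    1#         : Carrier
    isCommutativeRing : IsCommutativeRing _≡_ _+_ _*_ -_ 0# 1#
    0≢1        : 0# ≢ 1#
    inverse    : ∀ x → x ≢ 0# → ∃ λ y → x * y ≡ 1#
    enum       : Fin q ↔ Carrier

  elt : Fin q → Carrier
  elt = Inverse.to enum

  index : Carrier → Fin q
  index = Inverse.from enum

  _≟_ : (x y : Carrier) → Dec (x ≡ y)
  x ≟ y with index x F.≟ index y
  ... | yes p = yes (trans (sym (Inverse.strictlyInverseˡ enum x))
                      (trans (cong elt p) (Inverse.strictlyInverseˡ enum y)))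
  ... | no ¬p = no (λ e → ¬p (cong index e))

  -- subsets of the field are subsets of Fin q (via the enumeration)
  -- sum of all elements of a subset B
  ΣS : Subset q → Carrier
  ΣS B = foldr′ _+_ 0# (zipWith (λ b x → if b then x else 0#) B (tabulate elt))

  X : Subset q
  X = tabulate (λ i → not ⌊ elt i ≟ 0# ⌋ ∧ not ⌊ elt i ≟ 1# ⌋)

  -- W_k = { B ⊆ X : |B| = k, Σ B = 1, and no ℓ-subset (2 ≤ ℓ ≤ k-3)
  -- lies in W_ℓ }; the last condition is vacuous for k ≤ 4, so:
  W₂ : Subset q → Set
  W₂ B = B ⊆ X × ∣ B ∣ ≡ 2 × ΣS B ≡ 1#

  W₃ : Subset q → Set
  W₃ B = B ⊆ X × ∣ B ∣ ≡ 3 × ΣS B ≡ 1#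

record IsGDD {q : ℕ} (v n k λ' : ℕ) (X : Subset q)
             (G B : Subset q → Set) : Set where
  field
    size         : ∣ X ∣ ≡ v
    group-sub    : ∀ g → G g → g ⊆ X
    group-size   : ∀ g → G g → ∣ g ∣ ≡ n
    cover        : ∀ x → x ∈ X → ∃ λ g → G g × x ∈ g
    disjoint     : ∀ g g' x → G g → G g' → x ∈ g → x ∈ g' → g ≡ g'
    block-sub    : ∀ b → B b → b ⊆ X
    block-size   : ∀ b → B b → ∣ b ∣ ≡ k
    transversal  : ∀ b x y → B b → x ∈ b → y ∈ b → x ≢ y →
                   ∀ g → G g → ¬ (x ∈ g × y ∈ g)
    balance      : ∀ x y → x ∈ X → y ∈ X → x ≢ y →
                   (∀ g → G g → ¬ (x ∈ g × y ∈ g)) →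
                   Σ (List (Subset q)) λ bs →
                     length bs ≡ λ' × Unique bs ×
                     (∀ b → (B b × x ∈ b × y ∈ b) ⇔ (b ∈ₗ bs))

module Submission where

-- If 1 + 1 ≠ 0 then x ↦ -x is an involution of K whose
-- only fixed point is 0, so it splits the nonzero elements into pairs and q
-- is odd; since 2 ∣ q, we get 1 + 1 = 0.  (FiniteSubsets, Involutions,
-- characteristic-two.)
--
-- In characteristic two, a + b = 1 determines b = 1 + a, and
-- a + b + c = 1 determines c = 1 + a + b.  Hence the W₂-sets are exactly the
-- pairs {x, 1 + x} (the groups partition X into pairs), and for x, y ∈ X from
-- different groups the unique W₃-set through x and y is {x, y, 1 + x + y};
-- conversely a W₃-set never meets a group twice, because {x, 1 + x, z} would
-- force z = 0.  (Module CharacteristicTwo, ending in the record isGDD.)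

open import Defs
open import Data.Nat using (ℕ; zero; suc; _≤_; _^_; _∸_)
open import Data.Nat.Properties using (suc-injective)
import Data.Nat.Properties as ℕ
open import Data.Nat.Divisibility using (_∣_; _∣0; ∣-refl; ∣m∣n⇒∣m+n; ∣m+n∣m⇒∣n; ∣1⇒≡1; m∣m*n)
open import Data.Bool using (Bool; true; not; _∧_; if_then_else_)
open import Data.Fin using (Fin; zero; suc)
open import Data.Fin.Subset using (Subset; _∈_; _∉_; _⊆_; ∣_∣; inside; outside; ⊥; ⊤; ∁)
open import Data.Fin.Subset.Properties
  using (∉⊥; ∈⊤; ∣⊤∣≡n; ∣⊥∣≡0; Empty-unique; ⊆-antisym; x∈∁p⇒x∉p; x∉p⇒x∈∁p; ∣∁p∣≡n∸∣p∣)
open import Data.Vec using (Vec; []; _∷_; tabulate; lookup; foldr′; zipWith; here; there)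
open import Data.Vec.Properties using (lookup∘tabulate; []=⇒lookup; lookup⇒[]=)
open import Data.List using (List; [_]; length)
open import Data.List.Membership.Propositional using () renaming (_∈_ to _∈ₗ_)
open import Data.List.Relation.Unary.Unique.Propositional using (Unique)
open import Data.List.Relation.Unary.Any using (here)
open import Data.List.Relation.Unary.All using ([])
open import Data.List.Relation.Unary.AllPairs using ([]; _∷_)
open import Data.Product using (∃; _×_; _,_; proj₁; proj₂)
import Data.Product as Product
open import Data.Sum using (_⊎_; inj₁; inj₂; [_,_]′)
import Data.Sum as Sum
open import Data.Empty using (⊥-elim)
open import Function using (_∘_; id; _⇔_; mk⇔; Equivalence)
open import Function.Bundles using (Inverse)
open import Algebra.Bundles using (CommutativeRing; Group)
open import Level using (0ℓ)
open import Algebra.Structures using (IsCommutativeRing)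
import Algebra.Properties.Group as GroupProperties
open import Relation.Binary.PropositionalEquality
  using (_≡_; _≢_; refl; sym; trans; cong; cong₂; subst; module ≡-Reasoning)
open import Relation.Nullary using (¬_; yes; no)
open import Relation.Nullary.Decidable using (⌊_⌋)

private variable
  n : ℕ

module FiniteSubsets where

  -- p ∪ {i} and p \ {i}, by recursion so that their sizes are easy to track.
  insert : Fin n → Subset n → Subset n
  insert zero    (_ ∷ p) = inside ∷ p
  insert (suc i) (b ∷ p) = b ∷ insert i p

  remove : Fin n → Subset n → Subset n
  remove zero    (_ ∷ p) = outside ∷ p
  remove (suc i) (b ∷ p) = b ∷ remove i p

  ∈-insert-self : (i : Fin n) (p : Subset n) → i ∈ insert i p
  ∈-insert-self zero    (_ ∷ p) = here
  ∈-insert-self (suc i) (_ ∷ p) = there (∈-insert-self i p)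

  ∈-insert⁺ : (i : Fin n) {j : Fin n} {p : Subset n} → j ∈ p → j ∈ insert i p
  ∈-insert⁺ zero    here      = here
  ∈-insert⁺ zero    (there m) = there m
  ∈-insert⁺ (suc i) here      = here
  ∈-insert⁺ (suc i) (there m) = there (∈-insert⁺ i m)

  ∈-insert⁻ : (i : Fin n) {j : Fin n} (p : Subset n) → j ∈ insert i p → j ≡ i ⊎ j ∈ p
  ∈-insert⁻ zero    {zero}  (_ ∷ p) _         = inj₁ refl
  ∈-insert⁻ zero    {suc j} (_ ∷ p) (there m) = inj₂ (there m)
  ∈-insert⁻ (suc i) {zero}  (_ ∷ p) here      = inj₂ here
  ∈-insert⁻ (suc i) {suc j} (_ ∷ p) (there m) = Sum.map (cong suc) there (∈-insert⁻ i p m)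

  ∉-remove-self : (i : Fin n) (p : Subset n) → i ∉ remove i p
  ∉-remove-self (suc i) (_ ∷ p) (there m) = ∉-remove-self i p m

  ∈-remove⁺ : (i : Fin n) {j : Fin n} {p : Subset n} → j ≢ i → j ∈ p → j ∈ remove i p
  ∈-remove⁺ zero    {zero}  j≢i _         = ⊥-elim (j≢i refl)
  ∈-remove⁺ zero    {suc j} j≢i (there m) = there m
  ∈-remove⁺ (suc i) {zero}  j≢i here      = here
  ∈-remove⁺ (suc i) {suc j} j≢i (there m) = there (∈-remove⁺ i (j≢i ∘ cong suc) m)

  ∈-remove⁻ : (i : Fin n) {j : Fin n} (p : Subset n) → j ∈ remove i p → j ∈ p
  ∈-remove⁻ zero    {suc j} (_ ∷ p) (there m) = there m
  ∈-remove⁻ (suc i) {zero}  (_ ∷ p) here      = here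
  ∈-remove⁻ (suc i) {suc j} (_ ∷ p) (there m) = there (∈-remove⁻ i p m)

  ∈-remove⇒≢ : (i : Fin n) {j : Fin n} (p : Subset n) → j ∈ remove i p → j ≢ i
  ∈-remove⇒≢ i p m refl = ∉-remove-self i p m

  ∣insert∣ : (i : Fin n) (p : Subset n) → i ∉ p → ∣ insert i p ∣ ≡ suc ∣ p ∣
  ∣insert∣ zero    (inside  ∷ p) i∉p = ⊥-elim (i∉p here)
  ∣insert∣ zero    (outside ∷ p) i∉p = refl
  ∣insert∣ (suc i) (inside  ∷ p) i∉p = cong suc (∣insert∣ i p (i∉p ∘ there))
  ∣insert∣ (suc i) (outside ∷ p) i∉p = ∣insert∣ i p (i∉p ∘ there)

  ∣remove∣ : (i : Fin n) (p : Subset n) → i ∈ p → ∣ p ∣ ≡ suc ∣ remove i p ∣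
  ∣remove∣ zero    (inside  ∷ p) here      = refl
  ∣remove∣ (suc i) (inside  ∷ p) (there m) = cong suc (∣remove∣ i p m)
  ∣remove∣ (suc i) (outside ∷ p) (there m) = ∣remove∣ i p m

  insert-remove : (i : Fin n) (p : Subset n) → i ∈ p → insert i (remove i p) ≡ p
  insert-remove zero    (inside ∷ p) here      = refl
  insert-remove (suc i) (b ∷ p)      (there m) = cong (b ∷_) (insert-remove i p m)

  ∣p∣≡0⇒∉ : (p : Subset n) {i : Fin n} → ∣ p ∣ ≡ 0 → i ∉ p
  ∣p∣≡0⇒∉ (inside  ∷ p) ()   here
  ∣p∣≡0⇒∉ (outside ∷ p) size (there m) = ∣p∣≡0⇒∉ p size m

  nonempty : {k : ℕ} (p : Subset n) → ∣ p ∣ ≡ suc k → ∃ λ i → i ∈ p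
  nonempty (inside  ∷ p) _    = zero , here
  nonempty (outside ∷ p) size = Product.map suc there (nonempty p size)

  pair : Fin n → Fin n → Subset n
  pair a b = insert a (insert b ⊥)

  triple : Fin n → Fin n → Fin n → Subset n
  triple a b c = insert a (pair b c)

  ∈-singleton⁻ : {a j : Fin n} → j ∈ insert a ⊥ → j ≡ a
  ∈-singleton⁻ {a = a} m = [ id , ⊥-elim ∘ ∉⊥ ]′ (∈-insert⁻ a ⊥ m)

  ∈-pair⁻ : {a b j : Fin n} → j ∈ pair a b → j ≡ a ⊎ j ≡ b
  ∈-pair⁻ {a = a} m = Sum.map₂ ∈-singleton⁻ (∈-insert⁻ a _ m)

  ∈-triple⁻ : {a b c j : Fin n} → j ∈ triple a b c → j ≡ a ⊎ j ≡ b ⊎ j ≡ c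
  ∈-triple⁻ {a = a} m = Sum.map₂ ∈-pair⁻ (∈-insert⁻ a _ m)

  ∉-singleton : {a j : Fin n} → j ≢ a → j ∉ insert a ⊥
  ∉-singleton j≢a = j≢a ∘ ∈-singleton⁻

  ∉-pair : {a b j : Fin n} → j ≢ a → j ≢ b → j ∉ pair a b
  ∉-pair j≢a j≢b = [ j≢a , j≢b ]′ ∘ ∈-pair⁻

  ∣pair∣ : {a b : Fin n} → a ≢ b → ∣ pair a b ∣ ≡ 2
  ∣pair∣ {n} {a} {b} a≢b = trans (∣insert∣ a _ (∉-singleton a≢b))
    (cong suc (trans (∣insert∣ b ⊥ ∉⊥) (cong suc (∣⊥∣≡0 n))))

  ∣triple∣ : {a b c : Fin n} → a ≢ b → a ≢ c → b ≢ c → ∣ triple a b c ∣ ≡ 3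
  ∣triple∣ {a = a} a≢b a≢c b≢c = trans (∣insert∣ a _ (∉-pair a≢b a≢c)) (cong suc (∣pair∣ b≢c))

  singleton-form : (p : Subset n) → ∣ p ∣ ≡ 1 → ∃ λ w → p ≡ insert w ⊥
  singleton-form p size with nonempty p size
  ... | w , w∈p = w , trans (sym (insert-remove w p w∈p)) (cong (insert w) rest≡⊥)
    where
      rest≡⊥ : remove w p ≡ ⊥
      rest≡⊥ = Empty-unique λ (_ , m) →
        ∣p∣≡0⇒∉ (remove w p) (suc-injective (trans (sym (∣remove∣ w p w∈p)) size)) m

  pair-form : (p : Subset n) {x : Fin n} → ∣ p ∣ ≡ 2 → x ∈ p →
              ∃ λ y → y ≢ x × p ≡ pair x y
  pair-form p {x} size x∈p with singleton-form (remove x p) (suc-injective (trans (sym (∣remove∣ x p x∈p)) size))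
  ... | y , rest≡y = y , y≢x , trans (sym (insert-remove x p x∈p)) (cong (insert x) rest≡y)
    where
      y≢x : y ≢ x
      y≢x = ∈-remove⇒≢ x p (subst (y ∈_) (sym rest≡y) (∈-insert-self y ⊥))

  triple-form : (p : Subset n) {x y : Fin n} → ∣ p ∣ ≡ 3 → x ∈ p → y ∈ p → x ≢ y →
                ∃ λ w → w ≢ x × w ≢ y × p ≡ triple x y w
  triple-form p {x} {y} size x∈p y∈p x≢y with pair-form (remove x p) size′ y∈rest
    where
      y∈rest : y ∈ remove x p
      y∈rest = ∈-remove⁺ x (x≢y ∘ sym) y∈p
      size′ : ∣ remove x p ∣ ≡ 2
      size′ = suc-injective (trans (sym (∣remove∣ x p x∈p)) size)
  ... | w , w≢y , rest≡yw = w , w≢x , w≢y , trans (sym (insert-remove x p x∈p)) (cong (insert x) rest≡yw)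
    where
      w≢x : w ≢ x
      w≢x = ∈-remove⇒≢ x p (subst (w ∈_) (sym rest≡yw) (∈-insert⁺ y (∈-insert-self w ⊥)))

  ∈-tabulate : (P : Fin n → Bool) {i : Fin n} → i ∈ tabulate P ⇔ P i ≡ true
  ∈-tabulate P {i} = mk⇔ (λ m → trans (sym (lookup∘tabulate P i)) ([]=⇒lookup m))
                         (λ Pi → lookup⇒[]= i (tabulate P) (trans (lookup∘tabulate P i) Pi))

open FiniteSubsets

-- A subset closed under an involution f and containing no fixed point of f
-- is a disjoint union of orbits {a, f a}, hence has even size.
module Involutions (f : Fin n → Fin n) (involutive : ∀ a → f (f a) ≡ a) where

  Closed : Subset n → Set
  Closed p = ∀ {a} → a ∈ p → f a ∈ p

  FixedPointFree : Subset n → Set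
  FixedPointFree p = ∀ {a} → a ∈ p → f a ≢ a

  f-injective : ∀ {a b} → f a ≡ f b → a ≡ b
  f-injective {a} {b} fa≡fb = trans (sym (involutive a)) (trans (cong f fa≡fb) (involutive b))

  module RemoveOrbit (p : Subset n) (closed : Closed p) (free : FixedPointFree p)
                     {a : Fin n} (a∈p : a ∈ p) where

    fa∈p-a : f a ∈ remove a p
    fa∈p-a = ∈-remove⁺ a (free a∈p) (closed a∈p)

    rest : Subset n
    rest = remove (f a) (remove a p)

    ∈rest⁻ : ∀ {b} → b ∈ rest → b ∈ p
    ∈rest⁻ = ∈-remove⁻ a p ∘ ∈-remove⁻ (f a) (remove a p)

    ∣p∣≡2+∣rest∣ : ∣ p ∣ ≡ suc (suc ∣ rest ∣)
    ∣p∣≡2+∣rest∣ = trans (∣remove∣ a p a∈p) (cong suc (∣remove∣ (f a) (remove a p) fa∈p-a))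

    rest-closed : Closed rest
    rest-closed {b} b∈rest = ∈-remove⁺ (f a) (b≢a ∘ f-injective) (∈-remove⁺ a fb≢a (closed (∈rest⁻ b∈rest)))
      where
        b≢fa : b ≢ f a
        b≢fa = ∈-remove⇒≢ (f a) (remove a p) b∈rest
        b≢a : b ≢ a
        b≢a = ∈-remove⇒≢ a p (∈-remove⁻ (f a) (remove a p) b∈rest)
        fb≢a : f b ≢ a
        fb≢a fb≡a = b≢fa (trans (sym (involutive b)) (cong f fb≡a))

    rest-free : FixedPointFree rest
    rest-free = free ∘ ∈rest⁻

  -- Induction on the size k: a one-point set would have to contain both a
  -- and f a ≠ a, and a larger set is an orbit plus a smaller such set.
  even-size : ∀ k (p : Subset n) → ∣ p ∣ ≡ k → Closed p → FixedPointFree p → 2 ∣ k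
  even-size zero          p _    _      _    = 2 ∣0
  even-size (suc zero)    p size closed free with nonempty p size
  ... | a , a∈p = ⊥-elim (∣p∣≡0⇒∉ (remove a p) size-rest fa∈p-a)
    where
      open RemoveOrbit p closed free a∈p
      size-rest : ∣ remove a p ∣ ≡ 0
      size-rest = suc-injective (trans (sym (∣remove∣ a p a∈p)) size)
  even-size (suc (suc k)) p size closed free with nonempty p size
  ... | a , a∈p = ∣m∣n⇒∣m+n ∣-refl (even-size k rest size-rest rest-closed rest-free)
    where
      open RemoveOrbit p closed free a∈p
      size-rest : ∣ rest ∣ ≡ k
      size-rest = suc-injective (suc-injective (trans (sym ∣p∣≡2+∣rest∣) size))

module FieldFacts {q : ℕ} (K : FiniteField q) where
  open FiniteField K
  open IsCommutativeRing isCommutativeRing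
    using (+-comm; +-assoc; +-identityˡ; +-identityʳ; -‿inverseʳ; *-identityˡ; *-comm; *-assoc;
           distribʳ; zeroˡ; zeroʳ)
  open ≡-Reasoning

  +-group : Group 0ℓ 0ℓ
  +-group = CommutativeRing.+-group
    (record { Carrier = Carrier ; _≈_ = _≡_ ; _+_ = _+_ ; _*_ = _*_ ; -_ = -_ ; 0# = 0# ; 1# = 1#
            ; isCommutativeRing = isCommutativeRing })
  open GroupProperties +-group using (⁻¹-involutive; ε⁻¹≈ε)

  elt-index : ∀ c → elt (index c) ≡ c
  elt-index = Inverse.strictlyInverseˡ enum

  elt-injective : ∀ {i j} → elt i ≡ elt j → i ≡ j
  elt-injective {i} {j} eq = trans (sym (index-elt i)) (trans (cong index eq) (index-elt j))
    where
      index-elt : ∀ i → index (elt i) ≡ i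
      index-elt = Inverse.strictlyInverseʳ enum

  index≢ : ∀ {i c} → elt i ≢ c → i ≢ index c
  index≢ {c = c} elt-i≢c i≡index-c = elt-i≢c (trans (cong elt i≡index-c) (elt-index c))

  elt≢ : ∀ {i c} → i ≢ index c → elt i ≢ c
  elt≢ {i} {c} i≢index-c elt-i≡c = i≢index-c (elt-injective (trans elt-i≡c (sym (elt-index c))))


  +-exchange : ∀ a b c → a + (b + c) ≡ b + (a + c)
  +-exchange a b c = begin
    a + (b + c)  ≡⟨ sym (+-assoc a b c) ⟩
    (a + b) + c  ≡⟨ cong (_+ c) (+-comm a b) ⟩
    (b + a) + c  ≡⟨ +-assoc b a c ⟩
    b + (a + c)  ∎

  a+a≡[1+1]a : ∀ a → a + a ≡ (1# + 1#) * a
  a+a≡[1+1]a a = sym (trans (distribʳ a 1# 1#) (cong₂ _+_ (*-identityˡ a) (*-identityˡ a)))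

  -x≡x⇒x≡0 : 1# + 1# ≢ 0# → ∀ {a} → - a ≡ a → a ≡ 0#
  -x≡x⇒x≡0 two≢0 {a} -a≡a with inverse (1# + 1#) two≢0
  ... | u , two*u≡1 = begin
    a                      ≡⟨ sym (*-identityˡ a) ⟩
    1# * a                 ≡⟨ cong (_* a) (trans (sym two*u≡1) (*-comm _ u)) ⟩
    (u * (1# + 1#)) * a    ≡⟨ *-assoc u _ a ⟩
    u * ((1# + 1#) * a)    ≡⟨ cong (u *_) (sym (a+a≡[1+1]a a)) ⟩
    u * (a + a)            ≡⟨ cong (λ t → u * (a + t)) (sym -a≡a) ⟩
    u * (a + (- a))        ≡⟨ cong (u *_) (-‿inverseʳ a) ⟩
    u * 0#                 ≡⟨ zeroʳ u ⟩
    0#                     ∎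

  negate : Fin q → Fin q
  negate i = index (- elt i)

  negate-involutive : ∀ i → negate (negate i) ≡ i
  negate-involutive i = elt-injective (begin
    elt (index (- elt (index (- elt i))))  ≡⟨ elt-index _ ⟩
    - elt (index (- elt i))                ≡⟨ cong -_ (elt-index _) ⟩
    - (- elt i)                            ≡⟨ ⁻¹-involutive (elt i) ⟩
    elt i                                  ∎)

  -- The elements are 0 together with the nonzero ones, which negation
  -- pairs off when 1 + 1 ≠ 0; so then q is odd.
  nonzero : Subset q
  nonzero = remove (index 0#) ⊤

  q≡1+∣nonzero∣ : q ≡ suc ∣ nonzero ∣
  q≡1+∣nonzero∣ = trans (sym (∣⊤∣≡n q)) (∣remove∣ (index 0#) ⊤ ∈⊤)

  nonzero-even : 1# + 1# ≢ 0# → 2 ∣ ∣ nonzero ∣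
  nonzero-even two≢0 = even-size _ nonzero refl closed free
    where
      open Involutions negate negate-involutive
      negate-zero : negate (index 0#) ≡ index 0#
      negate-zero = cong index (trans (cong -_ (elt-index 0#)) ε⁻¹≈ε)
      -- -a = 0 forces a = -(-a) = -0 = 0
      closed : Closed nonzero
      closed {i} i∈nonzero = ∈-remove⁺ (index 0#) -i≢0 ∈⊤
        where
          -i≢0 : negate i ≢ index 0#
          -i≢0 -i≡0 = ∈-remove⇒≢ (index 0#) ⊤ i∈nonzero
            (trans (sym (negate-involutive i)) (trans (cong negate -i≡0) negate-zero))
      free : FixedPointFree nonzero
      free {i} i∈nonzero -i≡i = elt≢ (∈-remove⇒≢ (index 0#) ⊤ i∈nonzero)
        (-x≡x⇒x≡0 two≢0 (trans (sym (elt-index _)) (cong elt -i≡i)))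

  characteristic-two : 2 ∣ q → 1# + 1# ≡ 0#
  characteristic-two 2∣q with (1# + 1#) ≟ 0#
  ... | yes two≡0 = two≡0
  ... | no  two≢0 = ⊥-elim (2≢1 (∣1⇒≡1 2∣1))
    where
      2≢1 : 2 ≢ 1
      2≢1 ()
      2∣1 : 2 ∣ 1
      2∣1 = ∣m+n∣m⇒∣n (subst (2 ∣_) (trans q≡1+∣nonzero∣ (ℕ.+-comm 1 _)) 2∣q) (nonzero-even two≢0)

  -- Sums over subsets: ΣS p = sumOver p (tabulate elt).
  sumOver : Subset n → Vec Carrier n → Carrier
  sumOver p v = foldr′ _+_ 0# (zipWith (λ b x → if b then x else 0#) p v)

  sumOver-⊥ : (v : Vec Carrier n) → sumOver ⊥ v ≡ 0#
  sumOver-⊥ []      = refl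
  sumOver-⊥ (x ∷ v) = trans (+-identityˡ _) (sumOver-⊥ v)

  sumOver-insert : (i : Fin n) (p : Subset n) (v : Vec Carrier n) → i ∉ p →
                   sumOver (insert i p) v ≡ lookup v i + sumOver p v
  sumOver-insert zero    (inside  ∷ p) (x ∷ v) i∉p = ⊥-elim (i∉p here)
  sumOver-insert zero    (outside ∷ p) (x ∷ v) i∉p = cong (x +_) (sym (+-identityˡ _))
  sumOver-insert (suc i) (b ∷ p)       (x ∷ v) i∉p =
    trans (cong (_ +_) (sumOver-insert i p v (i∉p ∘ there))) (+-exchange _ (lookup v i) _)

  ΣS-insert : (i : Fin q) (p : Subset q) → i ∉ p → ΣS (insert i p) ≡ elt i + ΣS p
  ΣS-insert i p i∉p = trans (sumOver-insert i p (tabulate elt) i∉p) (cong (_+ ΣS p) (lookup∘tabulate elt i))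

  ΣS-pair : {a b : Fin q} → a ≢ b → ΣS (pair a b) ≡ elt a + elt b
  ΣS-pair {a} {b} a≢b = begin
    ΣS (pair a b)                  ≡⟨ ΣS-insert a _ (∉-singleton a≢b) ⟩
    elt a + ΣS (insert b ⊥)        ≡⟨ cong (elt a +_) (ΣS-insert b ⊥ ∉⊥) ⟩
    elt a + (elt b + ΣS ⊥)         ≡⟨ cong (λ t → elt a + (elt b + t)) (sumOver-⊥ (tabulate elt)) ⟩
    elt a + (elt b + 0#)           ≡⟨ cong (elt a +_) (+-identityʳ (elt b)) ⟩
    elt a + elt b                  ∎

  ΣS-triple : {a b c : Fin q} → a ≢ b → a ≢ c → b ≢ c → ΣS (triple a b c) ≡ elt a + (elt b + elt c)
  ΣS-triple {a} a≢b a≢c b≢c = trans (ΣS-insert a _ (∉-pair a≢b a≢c)) (cong (elt a +_) (ΣS-pair b≢c))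

  avoids-0-1 : ∀ c → (not ⌊ c ≟ 0# ⌋ ∧ not ⌊ c ≟ 1# ⌋) ≡ true ⇔ (c ≢ 0# × c ≢ 1#)
  avoids-0-1 c with c ≟ 0# | c ≟ 1#
  ... | yes c≡0 | _       = mk⇔ (λ ()) (λ (c≢0 , _) → ⊥-elim (c≢0 c≡0))
  ... | no  c≢0 | yes c≡1 = mk⇔ (λ ()) (λ (_ , c≢1) → ⊥-elim (c≢1 c≡1))
  ... | no  c≢0 | no  c≢1 = mk⇔ (λ _ → c≢0 , c≢1) (λ _ → refl)

  ∈X⇔ : ∀ {i} → i ∈ X ⇔ (elt i ≢ 0# × elt i ≢ 1#)
  ∈X⇔ {i} = mk⇔ (Equivalence.to (avoids-0-1 (elt i)) ∘ Equivalence.to (∈-tabulate _))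
                (Equivalence.from (∈-tabulate _) ∘ Equivalence.from (avoids-0-1 (elt i)))

  zero-one : Subset q
  zero-one = pair (index 0#) (index 1#)

  X≡∁zero-one : X ≡ ∁ zero-one
  X≡∁zero-one = ⊆-antisym
    (λ i∈X → let (≢0 , ≢1) = Equivalence.to ∈X⇔ i∈X in x∉p⇒x∈∁p (∉-pair (index≢ ≢0) (index≢ ≢1)))
    (λ i∈∁ → Equivalence.from ∈X⇔ (elt≢ (x∈∁p⇒x∉p i∈∁ ∘ is-0) , elt≢ (x∈∁p⇒x∉p i∈∁ ∘ is-1)))
    where
      is-0 : ∀ {i} → i ≡ index 0# → i ∈ zero-one
      is-0 refl = ∈-insert-self _ _
      is-1 : ∀ {i} → i ≡ index 1# → i ∈ zero-one
      is-1 refl = ∈-insert⁺ _ (∈-insert-self _ _)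

  ∣X∣≡q∸2 : ∣ X ∣ ≡ q ∸ 2
  ∣X∣≡q∸2 = begin
    ∣ X ∣               ≡⟨ cong ∣_∣ X≡∁zero-one ⟩
    ∣ ∁ zero-one ∣      ≡⟨ ∣∁p∣≡n∸∣p∣ zero-one ⟩
    q ∸ ∣ zero-one ∣    ≡⟨ cong (q ∸_) (∣pair∣ (index≢ (0≢1 ∘ trans (sym (elt-index 0#))))) ⟩
    q ∸ 2               ∎

  module CharacteristicTwo (two≡0 : 1# + 1# ≡ 0#) where

    a+a≡0 : ∀ a → a + a ≡ 0#
    a+a≡0 a = trans (a+a≡[1+1]a a) (trans (cong (_* a) two≡0) (zeroˡ a))

    -- Every element is its own negative, so a + b = c is solved by b = a + c.
    solve : ∀ {a b c} → a + b ≡ c → b ≡ a + c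
    solve {a} {b} {c} a+b≡c = begin
      b            ≡⟨ sym (+-identityˡ b) ⟩
      0# + b       ≡⟨ cong (_+ b) (sym (a+a≡0 a)) ⟩
      (a + a) + b  ≡⟨ +-assoc a a b ⟩
      a + (a + b)  ≡⟨ cong (a +_) a+b≡c ⟩
      a + c        ∎

    a+[1+a]≡1 : ∀ a → a + (1# + a) ≡ 1#
    a+[1+a]≡1 a = trans (+-exchange a 1# a) (trans (cong (1# +_) (a+a≡0 a)) (+-identityʳ 1#))

    partner : Fin q → Fin q
    partner x = index (1# + elt x)

    third : Fin q → Fin q → Fin q
    third x y = index (1# + (elt x + elt y))

    partner-sum : ∀ x → elt x + elt (partner x) ≡ 1#
    partner-sum x = trans (cong (elt x +_) (elt-index _)) (a+[1+a]≡1 (elt x))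

    third-sum : ∀ x y → elt x + (elt y + elt (third x y)) ≡ 1#
    third-sum x y = begin
      elt x + (elt y + elt (third x y))   ≡⟨ sym (+-assoc _ _ _) ⟩
      (elt x + elt y) + elt (third x y)   ≡⟨ cong ((elt x + elt y) +_) (elt-index _) ⟩
      (elt x + elt y) + (1# + (elt x + elt y))  ≡⟨ a+[1+a]≡1 _ ⟩
      1#                                  ∎

    partner-unique : ∀ {x y} → elt x + elt y ≡ 1# → y ≡ partner x
    partner-unique x+y≡1 = elt-injective (trans (solve x+y≡1) (trans (+-comm _ 1#) (sym (elt-index _))))

    third-unique : ∀ {x y w} → elt x + (elt y + elt w) ≡ 1# → w ≡ third x y
    third-unique x+y+w≡1 = elt-injective
      (trans (solve (trans (+-assoc _ _ _) x+y+w≡1)) (trans (+-comm _ 1#) (sym (elt-index _))))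

    third-value : ∀ {x y c} → elt (third x y) ≡ c → elt x + elt y ≡ 1# + c
    third-value third≡c = solve (trans (sym (elt-index _)) third≡c)

    group : Fin q → Subset q
    group x = pair x (partner x)

    block : Fin q → Fin q → Subset q
    block x y = triple x y (third x y)

    -- x = 1 + x would give 0 = x + x = 1.
    x≢partner : ∀ x → x ≢ partner x
    x≢partner x x≡px = 0≢1 (begin
      0#                       ≡⟨ sym (a+a≡0 (elt x)) ⟩
      elt x + elt x            ≡⟨ cong (λ z → elt x + elt z) x≡px ⟩
      elt x + elt (partner x)  ≡⟨ partner-sum x ⟩
      1#                       ∎)

    -- 1 + x is neither 0 nor 1, as x is neither 1 nor 0.
    partner-∈X : ∀ {x} → x ∈ X → partner x ∈ X
    partner-∈X {x} x∈X = Equivalence.from ∈X⇔ (px≢0 , px≢1)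
      where
        x≢0,1 : elt x ≢ 0# × elt x ≢ 1#
        x≢0,1 = Equivalence.to ∈X⇔ x∈X
        px≢0 : elt (partner x) ≢ 0#
        px≢0 px≡0 = proj₂ x≢0,1 (trans (solve (trans (sym (elt-index _)) px≡0)) (+-identityʳ 1#))
        px≢1 : elt (partner x) ≢ 1#
        px≢1 px≡1 = proj₁ x≢0,1 (trans (solve (trans (sym (elt-index _)) px≡1)) two≡0)

    group-W₂ : ∀ {x} → x ∈ X → W₂ (group x)
    group-W₂ {x} x∈X = group⊆X , ∣pair∣ (x≢partner x) , trans (ΣS-pair (x≢partner x)) (partner-sum x)
      where
        group⊆X : group x ⊆ X
        group⊆X j∈group with ∈-pair⁻ j∈group
        ... | inj₁ refl = x∈X
        ... | inj₂ refl = partner-∈X x∈X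

    W₂-is-group : ∀ {g x} → W₂ g → x ∈ g → g ≡ group x
    W₂-is-group {g} {x} (_ , ∣g∣≡2 , Σg≡1) x∈g with pair-form g ∣g∣≡2 x∈g
    ... | y , y≢x , g≡xy = trans g≡xy (cong (pair x) (partner-unique x+y≡1))
      where
        x+y≡1 : elt x + elt y ≡ 1#
        x+y≡1 = trans (sym (ΣS-pair (y≢x ∘ sym))) (trans (cong ΣS (sym g≡xy)) Σg≡1)

    block-W₃ : ∀ {x y} → x ∈ X → y ∈ X → x ≢ y → y ≢ partner x → W₃ (block x y)
    block-W₃ {x} {y} x∈X y∈X x≢y y≢px =
      block⊆X , ∣triple∣ x≢y (z≢x ∘ sym) (z≢y ∘ sym) ,
      trans (ΣS-triple x≢y (z≢x ∘ sym) (z≢y ∘ sym)) (third-sum x y)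
      where
        x≢0,1 : elt x ≢ 0# × elt x ≢ 1#
        x≢0,1 = Equivalence.to ∈X⇔ x∈X
        y≢0,1 : elt y ≢ 0# × elt y ≢ 1#
        y≢0,1 = Equivalence.to ∈X⇔ y∈X
        -- z = 1 + x + y equal to 0, 1, x or y would give y = 1 + x, y = x,
        -- y = 1 or x = 1 respectively
        z : Fin q
        z = third x y
        z≢0 : elt z ≢ 0#
        z≢0 z≡0 = y≢px (partner-unique (trans (third-value z≡0) (+-identityʳ 1#)))
        z≢1 : elt z ≢ 1#
        z≢1 z≡1 = x≢y (elt-injective (sym (trans (solve (trans (third-value z≡1) two≡0)) (+-identityʳ _))))
        z≢x : z ≢ x
        z≢x z≡x = proj₂ y≢0,1 (trans (solve (third-value (cong elt z≡x))) (a+[1+a]≡1 (elt x)))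
        z≢y : z ≢ y
        z≢y z≡y = proj₂ x≢0,1 (trans (solve (trans (+-comm _ _) (third-value (cong elt z≡y)))) (a+[1+a]≡1 (elt y)))
        block⊆X : block x y ⊆ X
        block⊆X j∈block with ∈-triple⁻ j∈block
        ... | inj₁ refl        = x∈X
        ... | inj₂ (inj₁ refl) = y∈X
        ... | inj₂ (inj₂ refl) = Equivalence.from ∈X⇔ (z≢0 , z≢1)

    W₃-is-block : ∀ {b x y} → W₃ b → x ∈ b → y ∈ b → x ≢ y → b ≡ block x y
    W₃-is-block {b} {x} {y} (_ , ∣b∣≡3 , Σb≡1) x∈b y∈b x≢y with triple-form b ∣b∣≡3 x∈b y∈b x≢y
    ... | w , w≢x , w≢y , b≡xyw = trans b≡xyw (cong (triple x y) (third-unique x+y+w≡1))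
      where
        x+y+w≡1 : elt x + (elt y + elt w) ≡ 1#
        x+y+w≡1 = trans (sym (ΣS-triple x≢y (w≢x ∘ sym) (w≢y ∘ sym))) (trans (cong ΣS (sym b≡xyw)) Σb≡1)

    -- A W₃-set never contains a whole group: {x, 1 + x, z} would force z = 0.
    W₃-avoids-partner : ∀ {b x y} → W₃ b → x ∈ b → y ∈ b → x ≢ y → y ≢ partner x
    W₃-avoids-partner {b} {x} {y} W₃b@(b⊆X , _) x∈b y∈b x≢y y≡px =
      proj₁ (Equivalence.to ∈X⇔ (b⊆X z∈b)) z≡0
      where
        z∈b : third x y ∈ b
        z∈b = subst (third x y ∈_) (sym (W₃-is-block W₃b x∈b y∈b x≢y))
                (∈-insert⁺ x (∈-insert⁺ y (∈-insert-self _ ⊥)))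
        z≡0 : elt (third x y) ≡ 0#
        z≡0 = begin
          elt (third x y)                 ≡⟨ elt-index _ ⟩
          1# + (elt x + elt y)            ≡⟨ cong (λ t → 1# + (elt x + elt t)) y≡px ⟩
          1# + (elt x + elt (partner x))  ≡⟨ cong (1# +_) (partner-sum x) ⟩
          1# + 1#                         ≡⟨ two≡0 ⟩
          0#                              ∎

    isGDD : IsGDD (q ∸ 2) 2 3 1 X W₂ W₃
    isGDD = record
      { size        = ∣X∣≡q∸2
      ; group-sub   = λ _ → proj₁
      ; group-size  = λ _ → proj₁ ∘ proj₂
      ; cover       = λ x x∈X → group x , group-W₂ x∈X , ∈-insert-self x _
      ; disjoint    = λ g g′ x W₂g W₂g′ x∈g x∈g′ →
                        trans (W₂-is-group W₂g x∈g) (sym (W₂-is-group W₂g′ x∈g′))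
      ; block-sub   = λ _ → proj₁
      ; block-size  = λ _ → proj₁ ∘ proj₂
      ; transversal = transversal
      ; balance     = balance
      }
      where
        -- two points of a group are x and 1 + x, which no block contains together
        transversal : ∀ b x y → W₃ b → x ∈ b → y ∈ b → x ≢ y → ∀ g → W₂ g → ¬ (x ∈ g × y ∈ g)
        transversal b x y W₃b x∈b y∈b x≢y g W₂g (x∈g , y∈g)
          with ∈-pair⁻ (subst (y ∈_) (W₂-is-group W₂g x∈g) y∈g)
        ... | inj₁ y≡x  = x≢y (sym y≡x)
        ... | inj₂ y≡px = W₃-avoids-partner W₃b x∈b y∈b x≢y y≡px

        -- the only block through x and y is {x, y, 1 + x + y}
        balance : ∀ x y → x ∈ X → y ∈ X → x ≢ y → (∀ g → W₂ g → ¬ (x ∈ g × y ∈ g)) →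
                  ∃ λ (bs : List (Subset q)) → length bs ≡ 1 × Unique bs ×
                    (∀ b → (W₃ b × x ∈ b × y ∈ b) ⇔ (b ∈ₗ bs))
        balance x y x∈X y∈X x≢y apart =
          [ block x y ] , refl , [] ∷ [] ,
          λ b → mk⇔ (λ (W₃b , x∈b , y∈b) → here (W₃-is-block W₃b x∈b y∈b x≢y))
                    (λ { (here refl) → block-W₃ x∈X y∈X x≢y y≢px ,
                                       ∈-insert-self x _ , ∈-insert⁺ x (∈-insert-self y _) })
          where
            y≢px : y ≢ partner x
            y≢px refl = apart (group x) (group-W₂ x∈X) (∈-insert-self x _ , ∈-insert⁺ x (∈-insert-self _ ⊥))

-- A field of order 2^m with m ≥ 1 has characteristic two, so the design exists.
theorem3p6 : (m : ℕ) → 3 ≤ m → (K : FiniteField (2 ^ m)) →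
    IsGDD ((2 ^ m) ∸ 2) 2 3 1 (FiniteField.X K) (FiniteField.W₂ K) (FiniteField.W₃ K)
theorem3p6 (suc m) _ K = CharacteristicTwo.isGDD (characteristic-two 2∣2^[1+m])
  where
    open FieldFacts K
    2∣2^[1+m] : 2 ∣ 2 ^ suc m
    2∣2^[1+m] = m∣m*n (2 ^ m)
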